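{- Let $U=\{u_1,\dots,u_n\}$ and let $\mathcal{F}_1,\mathcal{F}_2$ be families of subsets of $U$. Let $\mathcal{F}=\{S_1\cup S_2 \mid S_1\in\mathcal{F}_1,\ S_2\in\mathcal{F}_2,\ S_1\cap S_2=\emptyset\}$. Then $p_\psi(\mathcal{F}_1)\star p_\psi(\mathcal{F}_2)=p_\psi(\mathcal{F})$.
   Context: For $S\subseteq U$, the characteristic vector $\psi(S)$ is the $n$-bit binary string whose $j$-th bit is 1 iff $u_j\in S$, and $val(\psi(S))$ is the integer it represents in binary. The characteristic polynomial of a family $\mathcal{F}$ (a set of subsets, without multiplicity) is $p_\psi(\mathcal{F})=\sum_{S\in\mathcal{F}} z^{val(\psi(S))}$, a polynomial with integer coefficients. The Hamming weight $\mathcal{H}(d)$ of a nonnegative integer $d$ is the number of 1s in its binary representation. For $p(z)=\sum_i a_i z^i$: the Hamming projection $\mathcal{H}_h(p)=\sum_{i:\mathcal{H}(i)=h} a_i z^i$; the representative polynomial of $p$ is $\sum_i b_i z^i$ with $b_i=1$ if $a_i\neq 0$ and $b_i=0$ otherwise. For two polynomials $q(z),r(z)$ (of degree at most $2^n$, integer coefficients), $q\star r$ is defined as the representative polynomial of $\sum_{i,j\ge 0,\ i+j\le n}\mathcal{H}_{i+j}\big(\mathcal{H}_i(q)\cdot\mathcal{H}_j(r)\big)$, where $\cdot$ is ordinary polynomial multiplication (this is what the paper's Algorithm computes, using FFT-based multiplication). -}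

module Defs where

open import Data.Bool using (Bool; true; false; if_then_else_; _∧_; T)
open import Data.Nat using (ℕ; zero; suc; _+_; _*_; _∸_; _^_; _≡ᵇ_; _%_; _/_)
open import Data.Integer as ℤ using (ℤ; 0ℤ; 1ℤ)
open import Data.List using (List; []; _∷_; map; _++_; foldr; upTo)
open import Data.Vec using (Vec; []; _∷_)
open import Data.Fin.Subset using (Subset; inside; outside)

allSubsets : (n : ℕ) → List (Subset n)
allSubsets zero = [] ∷ []
allSubsets (suc n) = map (inside ∷_) (allSubsets n) ++ map (outside ∷_) (allSubsets n)

Family : ℕ → Set
Family n = Subset n → Bool

-- val(ψ(S)): the characteristic vector read as an n-bit binary string
-- (first position = bit for u_1, most significant)
bitVal : Bool → ℕ
bitVal true = 1
bitVal false = 0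

val : {n : ℕ} → Subset n → ℕ
val {zero} [] = 0
val {suc n} (b ∷ v) = bitVal b * 2 ^ n + val v

-- Polynomials with integer coefficients: coefficient functions
-- (p i = coefficient of z^i); the ones considered have finite support.
Poly : Set
Poly = ℕ → ℤ

sumℤ : List ℤ → ℤ
sumℤ = foldr ℤ._+_ 0ℤ

-- characteristic polynomial p_ψ(F) = Σ_{S ∈ F} z^{val(ψ(S))}
pψ : {n : ℕ} → Family n → Poly
pψ {n} F d = sumℤ (map (λ S → if F S ∧ (val S ≡ᵇ d) then 1ℤ else 0ℤ) (allSubsets n))

-- Hamming weight of a natural number (number of 1s in binary);
-- fuel d suffices for d
hwFuel : ℕ → ℕ → ℕ
hwFuel zero d = 0
hwFuel (suc k) d = d % 2 + hwFuel k (d / 2)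

hamming : ℕ → ℕ
hamming d = hwFuel d d

hproj : ℕ → Poly → Poly
hproj h p i = if hamming i ≡ᵇ h then p i else 0ℤ

_·_ : Poly → Poly → Poly
(p · q) k = sumℤ (map (λ i → p i ℤ.* q (k ∸ i)) (upTo (suc k)))

_⊕_ : Poly → Poly → Poly
(p ⊕ q) k = p k ℤ.+ q k

zeroP : Poly
zeroP _ = 0ℤ

sumP : List Poly → Poly
sumP = foldr _⊕_ zeroP

representative : Poly → Poly
representative p i with p i
... | ℤ.+ zero = 0ℤ
... | _ = 1ℤ

star : ℕ → Poly → Poly → Poly
star n q r = representative
  (sumP (map (λ i → sumP (map (λ j → hproj (i + j) (hproj i q · hproj j r))
                              (upTo (suc (n ∸ i)))))
             (upTo (suc n))))

-- For q and r with nonnegative coefficients, the coefficient of z^d in the sum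
-- whose representative is q ⋆ r is a sum of nonnegative products q a · r b with
-- a + b = d, each kept only when hamming d = hamming a + hamming b, i.e. when the
-- addition a + b has no carries. For codes of subsets,
-- hamming (val S₁ + val S₂) ≤ ∣S₁∣ + ∣S₂∣ with equality iff S₁ ∩ S₂ = ∅, since a
-- common element produces a carry, which loses at least one 1-bit; and for disjoint
-- sets val (S₁ ∪ S₂) = val S₁ + val S₂. Hence the coefficient is nonzero iff d is
-- the code of a member of F, and taking representatives yields p_ψ(F).
module Submission where

open import Data.Bool using (true; false; T; if_then_else_; _∧_; _∨_)
import Data.Bool.Properties as Bool
open import Data.Fin.Subset using (Subset; inside; outside; _∪_; _∩_; ⊥; ∣_∣)
open import Data.Fin.Subset.Properties using (∣p∣≤n)
open import Data.Integer as ℤ using (ℤ; 0ℤ; 1ℤ; +≤+; +<+)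
import Data.Integer.Properties as ℤ
open import Data.List using (List; []; _∷_; map; _++_; upTo)
import Data.List.Properties as List
open import Data.List.Membership.Propositional using (_∈_)
open import Data.List.Membership.Propositional.Properties using (∈-upTo⁺; ∈-upTo⁻)
open import Data.List.Relation.Unary.Any using (here; there)
open import Data.Nat
open import Data.Nat.DivMod
open import Data.Nat.Properties
open import Algebra.Properties.CommutativeSemigroup +-commutativeSemigroup
  using (interchange; x∙yz≈y∙xz; xy∙z≈x∙zy; xy∙z≈xz∙y)
open import Data.Nat.Tactic.RingSolver using (solve-∀)
open import Data.Product using (Σ; _×_; _,_)
open import Data.Vec using ([]; _∷_)
import Data.Vec.Properties as Vec
open import Function using (_∘_)
open import Function.Bundles using (_⇔_; mk⇔; module Equivalence)
open import Function.Construct.Composition using (_⇔-∘_)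
open import Function.Construct.Symmetry using (⇔-sym)
open import Relation.Binary.PropositionalEquality
open import Relation.Nullary using (yes; no; contradiction)
open import Relation.Nullary.Decidable using (decidable-stable)

open import Defs

hwFuel-zero : ∀ k → hwFuel k 0 ≡ 0
hwFuel-zero zero = refl
hwFuel-zero (suc k) = hwFuel-zero k

m≤1+n⇒m/2≤n : ∀ m k → m ≤ suc k → m / 2 ≤ k
m≤1+n⇒m/2≤n zero k _ = z≤n
m≤1+n⇒m/2≤n (suc m) k m≤1+k = ≤-pred (<-≤-trans (m/n<m (suc m) 2 (s≤s (s≤s z≤n))) m≤1+k)

hwFuel-sufficient : ∀ k k′ m → m ≤ k → m ≤ k′ → hwFuel k m ≡ hwFuel k′ m
hwFuel-sufficient zero k′ zero _ _ = sym (hwFuel-zero k′)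
hwFuel-sufficient (suc k) zero zero _ _ = hwFuel-zero (suc k)
hwFuel-sufficient (suc k) (suc k′) m m≤k m≤k′ =
  cong (m % 2 +_) (hwFuel-sufficient k k′ (m / 2) (m≤1+n⇒m/2≤n m k m≤k) (m≤1+n⇒m/2≤n m k′ m≤k′))

hamming-unfold : ∀ d → hamming d ≡ d % 2 + hamming (d / 2)
hamming-unfold zero = refl
hamming-unfold (suc k) =
  cong (suc k % 2 +_) (hwFuel-sufficient k (suc k / 2) (suc k / 2) (m≤1+n⇒m/2≤n (suc k) k ≤-refl) ≤-refl)

hwFuel≤ : ∀ k d → hwFuel k d ≤ d
hwFuel≤ zero d = z≤n
hwFuel≤ (suc k) d = begin
  d % 2 + hwFuel k (d / 2)  ≤⟨ +-monoʳ-≤ (d % 2) (≤-trans (hwFuel≤ k (d / 2)) (m≤m*n (d / 2) 2)) ⟩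
  d % 2 + d / 2 * 2         ≡⟨ m≡m%n+[m/n]*n d 2 ⟨
  d                         ∎
  where open ≤-Reasoning

hamming≤ : ∀ d → hamming d ≤ d
hamming≤ d = hwFuel≤ d d

hamming-bit+2* : ∀ b k → b < 2 → hamming (b + k * 2) ≡ b + hamming k
hamming-bit+2* b k b<2 = begin
  hamming (b + k * 2)                                  ≡⟨ hamming-unfold (b + k * 2) ⟩
  (b + k * 2) % 2 + hamming ((b + k * 2) / 2)          ≡⟨ cong₂ (λ r q → r + hamming q) low high ⟩
  b + hamming k                                        ∎
  where
  open ≡-Reasoning
  low : (b + k * 2) % 2 ≡ b
  low = trans ([m+kn]%n≡m%n b k 2) (m<n⇒m%n≡m b<2)
  high : (b + k * 2) / 2 ≡ k
  high = begin
    (b + k * 2) / 2      ≡⟨ +-distrib-/ b (k * 2) no-overflow ⟩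
    b / 2 + k * 2 / 2    ≡⟨ cong₂ _+_ (m<n⇒m/n≡0 b<2) (m*n/n≡m k 2) ⟩
    k                    ∎
    where
    no-overflow : b % 2 + k * 2 % 2 < 2
    no-overflow = subst₂ (λ r s → r + s < 2) (sym (m<n⇒m%n≡m b<2)) (sym (m*n%n≡0 k 2))
                         (subst (_< 2) (sym (+-identityʳ b)) b<2)

hamming-*2^+ : ∀ n x y → y < 2 ^ n → hamming (x * 2 ^ n + y) ≡ hamming x + hamming y
hamming-*2^+ zero x zero _ = begin
  hamming (x * 1 + 0)  ≡⟨ cong hamming (trans (+-identityʳ (x * 1)) (*-identityʳ x)) ⟩
  hamming x            ≡⟨ +-identityʳ (hamming x) ⟨
  hamming x + 0        ∎
  where open ≡-Reasoning
hamming-*2^+ zero x (suc y) (s≤s ())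
hamming-*2^+ (suc n) x y y<2^1+n = begin
  hamming (x * 2 ^ suc n + y)        ≡⟨ cong hamming regroup ⟩
  hamming (r + (x * 2 ^ n + q) * 2)  ≡⟨ hamming-bit+2* r (x * 2 ^ n + q) r<2 ⟩
  r + hamming (x * 2 ^ n + q)        ≡⟨ cong (r +_) (hamming-*2^+ n x q q<2^n) ⟩
  r + (hamming x + hamming q)        ≡⟨ x∙yz≈y∙xz r (hamming x) (hamming q) ⟩
  hamming x + (r + hamming q)        ≡⟨ cong (hamming x +_) (hamming-bit+2* r q r<2) ⟨
  hamming x + hamming (r + q * 2)    ≡⟨ cong (λ z → hamming x + hamming z) (m≡m%n+[m/n]*n y 2) ⟨
  hamming x + hamming y              ∎
  where
  open ≡-Reasoning
  r q : ℕ
  r = y % 2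
  q = y / 2
  r<2 : r < 2
  r<2 = m%n<n y 2
  q<2^n : q < 2 ^ n
  q<2^n = m<n*o⇒m/o<n (subst (y <_) (*-comm 2 (2 ^ n)) y<2^1+n)
  regroup : x * 2 ^ suc n + y ≡ r + (x * 2 ^ n + q) * 2
  regroup = trans (cong (x * 2 ^ suc n +_) (m≡m%n+[m/n]*n y 2)) (lemma x (2 ^ n) r q)
    where
    lemma : ∀ x p r q → x * (2 * p) + (r + q * 2) ≡ r + (x * p + q) * 2
    lemma = solve-∀

hamming-≤1 : ∀ {t} → t ≤ 1 → hamming t ≡ t
hamming-≤1 z≤n = refl
hamming-≤1 (s≤s z≤n) = refl

hamming-2+t< : ∀ {t} → t ≤ 1 → hamming (2 + t) < 2 + t
hamming-2+t< z≤n = ≤-refl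
hamming-2+t< (s≤s z≤n) = ≤-refl

∣∷∣ : ∀ {n} b (S : Subset n) → ∣ b ∷ S ∣ ≡ bitVal b + ∣ S ∣
∣∷∣ true S = refl
∣∷∣ false S = refl

∣∷∣+∣∷∣ : ∀ {n} b c (S T : Subset n) → ∣ b ∷ S ∣ + ∣ c ∷ T ∣ ≡ bitVal b + bitVal c + (∣ S ∣ + ∣ T ∣)
∣∷∣+∣∷∣ b c S T = trans (cong₂ _+_ (∣∷∣ b S) (∣∷∣ c T)) (interchange (bitVal b) (∣ S ∣) (bitVal c) (∣ T ∣))

val-∷ : ∀ {n} b c (S T : Subset n) → val (b ∷ S) + val (c ∷ T) ≡ (bitVal b + bitVal c) * 2 ^ n + (val S + val T)
val-∷ {n} b c S T = begin
  bitVal b * 2 ^ n + val S + (bitVal c * 2 ^ n + val T)    ≡⟨ interchange (bitVal b * 2 ^ n) (val S) (bitVal c * 2 ^ n) (val T) ⟩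
  bitVal b * 2 ^ n + bitVal c * 2 ^ n + (val S + val T)    ≡⟨ cong (_+ (val S + val T)) (*-distribʳ-+ (2 ^ n) (bitVal b) (bitVal c)) ⟨
  (bitVal b + bitVal c) * 2 ^ n + (val S + val T)          ∎
  where open ≡-Reasoning

bitVal*2^n≤2^n : ∀ b n → bitVal b * 2 ^ n ≤ 2 ^ n
bitVal*2^n≤2^n true n = ≤-reflexive (*-identityˡ (2 ^ n))
bitVal*2^n≤2^n false n = z≤n

val< : ∀ {n} (S : Subset n) → val S < 2 ^ n
val< [] = s≤s z≤n
val< {suc n} (b ∷ S) = begin-strict
  bitVal b * 2 ^ n + val S  <⟨ +-mono-≤-< (bitVal*2^n≤2^n b n) (val< S) ⟩
  2 ^ n + 2 ^ n             ≡⟨ cong (2 ^ n +_) (+-identityʳ (2 ^ n)) ⟨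
  2 ^ suc n                 ∎
  where open ≤-Reasoning

2^n≤val-inside∷ : ∀ {n} (S : Subset n) → 2 ^ n ≤ val (inside ∷ S)
2^n≤val-inside∷ {n} S = subst (_≤ val (inside ∷ S)) (*-identityˡ (2 ^ n)) (m≤m+n (1 * 2 ^ n) (val S))

val-injective : ∀ {n} (S T : Subset n) → val S ≡ val T → S ≡ T
val-injective [] [] _ = refl
val-injective {suc n} (inside ∷ S) (inside ∷ T) eq = cong (inside ∷_) (val-injective S T (+-cancelˡ-≡ (1 * 2 ^ n) (val S) (val T) eq))
val-injective (outside ∷ S) (outside ∷ T) eq = cong (outside ∷_) (val-injective S T eq)
val-injective {suc n} (inside ∷ S) (outside ∷ T) eq = contradiction (subst (2 ^ n ≤_) eq (2^n≤val-inside∷ S)) (<⇒≱ (val< T))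
val-injective {suc n} (outside ∷ S) (inside ∷ T) eq = contradiction (subst (2 ^ n ≤_) (sym eq) (2^n≤val-inside∷ T)) (<⇒≱ (val< S))

hamming-val : ∀ {n} (S : Subset n) → hamming (val S) ≡ ∣ S ∣
hamming-val [] = refl
hamming-val {suc n} (b ∷ S) = begin
  hamming (bitVal b * 2 ^ n + val S)      ≡⟨ hamming-*2^+ n (bitVal b) (val S) (val< S) ⟩
  hamming (bitVal b) + hamming (val S)    ≡⟨ cong₂ _+_ (hamming-bitVal b) (hamming-val S) ⟩
  bitVal b + ∣ S ∣                        ≡⟨ ∣∷∣ b S ⟨
  ∣ b ∷ S ∣                               ∎
  where
  open ≡-Reasoning
  hamming-bitVal : ∀ b → hamming (bitVal b) ≡ bitVal b
  hamming-bitVal true = refl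
  hamming-bitVal false = refl

bitVal-∨ : ∀ b c → b ∧ c ≡ false → bitVal (b ∨ c) ≡ bitVal b + bitVal c
bitVal-∨ true false _ = refl
bitVal-∨ false c _ = refl

val-∪ : ∀ {n} (S T : Subset n) → S ∩ T ≡ ⊥ → val (S ∪ T) ≡ val S + val T
val-∪ [] [] _ = refl
val-∪ {suc n} (b ∷ S) (c ∷ T) disj = begin
  bitVal (b ∨ c) * 2 ^ n + val (S ∪ T)             ≡⟨ cong₂ (λ x y → x * 2 ^ n + y) (bitVal-∨ b c (Vec.∷-injectiveˡ disj)) (val-∪ S T (Vec.∷-injectiveʳ disj)) ⟩
  (bitVal b + bitVal c) * 2 ^ n + (val S + val T)  ≡⟨ val-∷ b c S T ⟨
  val (b ∷ S) + val (c ∷ T)                        ∎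
  where open ≡-Reasoning

∣∪∣ : ∀ {n} (S T : Subset n) → S ∩ T ≡ ⊥ → ∣ S ∪ T ∣ ≡ ∣ S ∣ + ∣ T ∣
∣∪∣ [] [] _ = refl
∣∪∣ {suc n} (b ∷ S) (c ∷ T) disj = begin
  ∣ (b ∨ c) ∷ (S ∪ T) ∣                       ≡⟨ ∣∷∣ (b ∨ c) (S ∪ T) ⟩
  bitVal (b ∨ c) + ∣ S ∪ T ∣                  ≡⟨ cong₂ _+_ (bitVal-∨ b c (Vec.∷-injectiveˡ disj)) (∣∪∣ S T (Vec.∷-injectiveʳ disj)) ⟩
  bitVal b + bitVal c + (∣ S ∣ + ∣ T ∣)        ≡⟨ ∣∷∣+∣∷∣ b c S T ⟨
  ∣ b ∷ S ∣ + ∣ c ∷ T ∣                        ∎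
  where open ≡-Reasoning

-- t is the carry out of the lower n bits when adding the codes.
hamming-val+val-∷ : ∀ {n} b c (S T : Subset n) → Σ ℕ λ t → t ≤ 1 ×
  hamming (val (b ∷ S) + val (c ∷ T)) + t ≡ hamming (bitVal b + bitVal c + t) + hamming (val S + val T)
hamming-val+val-∷ {n} b c S T = t , t≤1 , (begin
  hamming (val (b ∷ S) + val (c ∷ T)) + t         ≡⟨ cong (λ x → hamming x + t) (trans (val-∷ b c S T) regroup) ⟩
  hamming ((B + t) * 2 ^ n + u) + t               ≡⟨ cong (_+ t) (hamming-*2^+ n (B + t) u u<2^n) ⟩
  hamming (B + t) + hamming u + t                 ≡⟨ xy∙z≈x∙zy (hamming (B + t)) (hamming u) t ⟩
  hamming (B + t) + (t + hamming u)               ≡⟨ cong (λ x → hamming (B + t) + (x + hamming u)) (hamming-≤1 t≤1) ⟨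
  hamming (B + t) + (hamming t + hamming u)       ≡⟨ cong (hamming (B + t) +_) (hamming-*2^+ n t u u<2^n) ⟨
  hamming (B + t) + hamming (t * 2 ^ n + u)       ≡⟨ cong (λ x → hamming (B + t) + hamming x) s≡t*2^n+u ⟨
  hamming (B + t) + hamming (val S + val T)       ∎)
  where
  open ≡-Reasoning
  instance
    2^n-nonZero : NonZero (2 ^ n)
    2^n-nonZero = m^n≢0 2 n
  B s t u : ℕ
  B = bitVal b + bitVal c
  s = val S + val T
  t = s / 2 ^ n
  u = s % 2 ^ n
  t≤1 : t ≤ 1
  t≤1 = ≤-pred (m<n*o⇒m/o<n (subst (s <_) (cong (2 ^ n +_) (sym (+-identityʳ (2 ^ n)))) (+-mono-< (val< S) (val< T))))
  u<2^n : u < 2 ^ n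
  u<2^n = m%n<n s (2 ^ n)
  s≡t*2^n+u : s ≡ t * 2 ^ n + u
  s≡t*2^n+u = trans (m≡m%n+[m/n]*n s (2 ^ n)) (+-comm u (t * 2 ^ n))
  regroup : B * 2 ^ n + s ≡ (B + t) * 2 ^ n + u
  regroup = trans (cong (B * 2 ^ n +_) s≡t*2^n+u) (lemma B t (2 ^ n) u)
    where
    lemma : ∀ x t p u → x * p + (t * p + u) ≡ (x + t) * p + u
    lemma = solve-∀

hamming-val+val-∷-≤ : ∀ {n} b c (S T : Subset n) →
  hamming (val (b ∷ S) + val (c ∷ T)) ≤ bitVal b + bitVal c + hamming (val S + val T)
hamming-val+val-∷-≤ b c S T with hamming-val+val-∷ b c S T
... | t , t≤1 , eq = +-cancelʳ-≤ t _ _ (begin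
  hamming (val (b ∷ S) + val (c ∷ T)) + t      ≡⟨ eq ⟩
  hamming (B + t) + hamming (val S + val T)    ≤⟨ +-monoˡ-≤ _ (hamming≤ (B + t)) ⟩
  B + t + hamming (val S + val T)              ≡⟨ xy∙z≈xz∙y B t _ ⟩
  B + hamming (val S + val T) + t              ∎)
  where
  open ≤-Reasoning
  B : ℕ
  B = bitVal b + bitVal c

hamming-val+val-inside∷-< : ∀ {n} (S T : Subset n) →
  hamming (val (inside ∷ S) + val (inside ∷ T)) < 2 + hamming (val S + val T)
hamming-val+val-inside∷-< S T with hamming-val+val-∷ inside inside S T
... | t , t≤1 , eq = +-cancelʳ-< t _ _ (begin-strict
  hamming (val (inside ∷ S) + val (inside ∷ T)) + t  ≡⟨ eq ⟩
  hamming (2 + t) + hamming (val S + val T)          <⟨ +-monoˡ-< _ (hamming-2+t< t≤1) ⟩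
  2 + t + hamming (val S + val T)                    ≡⟨ xy∙z≈xz∙y 2 t _ ⟩
  2 + hamming (val S + val T) + t                    ∎)
  where open ≤-Reasoning

hamming-val+val≤ : ∀ {n} (S T : Subset n) → hamming (val S + val T) ≤ ∣ S ∣ + ∣ T ∣
hamming-val+val≤ [] [] = z≤n
hamming-val+val≤ (b ∷ S) (c ∷ T) = begin
  hamming (val (b ∷ S) + val (c ∷ T))                ≤⟨ hamming-val+val-∷-≤ b c S T ⟩
  bitVal b + bitVal c + hamming (val S + val T)      ≤⟨ +-monoʳ-≤ (bitVal b + bitVal c) (hamming-val+val≤ S T) ⟩
  bitVal b + bitVal c + (∣ S ∣ + ∣ T ∣)               ≡⟨ ∣∷∣+∣∷∣ b c S T ⟨
  ∣ b ∷ S ∣ + ∣ c ∷ T ∣                               ∎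
  where open ≤-Reasoning

hamming-val+val<-∷ : ∀ {n} b c (S T : Subset n) → hamming (val S + val T) < ∣ S ∣ + ∣ T ∣ →
  hamming (val (b ∷ S) + val (c ∷ T)) < ∣ b ∷ S ∣ + ∣ c ∷ T ∣
hamming-val+val<-∷ b c S T h< = begin-strict
  hamming (val (b ∷ S) + val (c ∷ T))                ≤⟨ hamming-val+val-∷-≤ b c S T ⟩
  bitVal b + bitVal c + hamming (val S + val T)      <⟨ +-monoʳ-< (bitVal b + bitVal c) h< ⟩
  bitVal b + bitVal c + (∣ S ∣ + ∣ T ∣)               ≡⟨ ∣∷∣+∣∷∣ b c S T ⟨
  ∣ b ∷ S ∣ + ∣ c ∷ T ∣                               ∎
  where open ≤-Reasoning

hamming-val+val< : ∀ {n} (S T : Subset n) → S ∩ T ≢ ⊥ → hamming (val S + val T) < ∣ S ∣ + ∣ T ∣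
hamming-val+val< [] [] S∩T≢⊥ = contradiction refl S∩T≢⊥
hamming-val+val< (inside ∷ S) (inside ∷ T) _ = begin-strict
  hamming (val (inside ∷ S) + val (inside ∷ T))  <⟨ hamming-val+val-inside∷-< S T ⟩
  2 + hamming (val S + val T)                    ≤⟨ +-monoʳ-≤ 2 (hamming-val+val≤ S T) ⟩
  2 + (∣ S ∣ + ∣ T ∣)                             ≡⟨ ∣∷∣+∣∷∣ inside inside S T ⟨
  ∣ inside ∷ S ∣ + ∣ inside ∷ T ∣                 ∎
  where open ≤-Reasoning
hamming-val+val< (inside ∷ S) (outside ∷ T) S∩T≢⊥ =
  hamming-val+val<-∷ inside outside S T (hamming-val+val< S T (S∩T≢⊥ ∘ cong (outside ∷_)))
hamming-val+val< (outside ∷ S) (c ∷ T) S∩T≢⊥ =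
  hamming-val+val<-∷ outside c S T (hamming-val+val< S T (S∩T≢⊥ ∘ cong (outside ∷_)))

disjoint⇔hamming-val+val≡ : ∀ {n} (S T : Subset n) → S ∩ T ≡ ⊥ ⇔ hamming (val S + val T) ≡ ∣ S ∣ + ∣ T ∣
disjoint⇔hamming-val+val≡ S T = mk⇔ no-carries disjoint
  where
  no-carries : S ∩ T ≡ ⊥ → hamming (val S + val T) ≡ ∣ S ∣ + ∣ T ∣
  no-carries S∩T≡⊥ = begin
    hamming (val S + val T)  ≡⟨ cong hamming (val-∪ S T S∩T≡⊥) ⟨
    hamming (val (S ∪ T))    ≡⟨ hamming-val (S ∪ T) ⟩
    ∣ S ∪ T ∣                ≡⟨ ∣∪∣ S T S∩T≡⊥ ⟩
    ∣ S ∣ + ∣ T ∣            ∎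
    where open ≡-Reasoning
  disjoint : hamming (val S + val T) ≡ ∣ S ∣ + ∣ T ∣ → S ∩ T ≡ ⊥
  disjoint eq = decidable-stable (Vec.≡-dec Bool._≟_ (S ∩ T) ⊥) (λ S∩T≢⊥ → <⇒≢ (hamming-val+val< S T S∩T≢⊥) eq)

*-nonneg : ∀ {x y} → 0ℤ ℤ.≤ x → 0ℤ ℤ.≤ y → 0ℤ ℤ.≤ x ℤ.* y
*-nonneg {ℤ.+ m} {ℤ.+ n} (+≤+ _) (+≤+ _) = subst (0ℤ ℤ.≤_) (ℤ.pos-* m n) (+≤+ z≤n)

*-pos : ∀ {x y} → 0ℤ ℤ.< x → 0ℤ ℤ.< y → 0ℤ ℤ.< x ℤ.* y
*-pos {ℤ.+ suc m} {ℤ.+ suc n} (+<+ _) (+<+ _) = +<+ (s≤s z≤n)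

*-≢0 : ∀ x y → x ℤ.* y ≢ 0ℤ → x ≢ 0ℤ × y ≢ 0ℤ
*-≢0 x y xy≢0 = (λ x≡0 → xy≢0 (cong (ℤ._* y) x≡0)) , (λ y≡0 → xy≢0 (trans (cong (x ℤ.*_) y≡0) (ℤ.*-zeroʳ x)))

module _ {A : Set} (f : A → ℤ) where

  sumℤ-++ : ∀ xs ys → sumℤ (map f (xs ++ ys)) ≡ sumℤ (map f xs) ℤ.+ sumℤ (map f ys)
  sumℤ-++ [] ys = sym (ℤ.+-identityˡ _)
  sumℤ-++ (x ∷ xs) ys = trans (cong (ℤ._+_ (f x)) (sumℤ-++ xs ys)) (sym (ℤ.+-assoc (f x) _ _))

  sumℤ-zero : ∀ xs → (∀ x → f x ≡ 0ℤ) → sumℤ (map f xs) ≡ 0ℤ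
  sumℤ-zero [] _ = refl
  sumℤ-zero (x ∷ xs) f≡0 = cong₂ ℤ._+_ (f≡0 x) (sumℤ-zero xs f≡0)

  sumℤ-≢0 : ∀ xs → sumℤ (map f xs) ≢ 0ℤ → Σ A λ x → x ∈ xs × f x ≢ 0ℤ
  sumℤ-≢0 [] sum≢0 = contradiction refl sum≢0
  sumℤ-≢0 (x ∷ xs) sum≢0 with f x ℤ.≟ 0ℤ
  ... | no fx≢0 = x , here refl , fx≢0
  ... | yes fx≡0 with sumℤ-≢0 xs (λ rest≡0 → sum≢0 (cong₂ ℤ._+_ fx≡0 rest≡0))
  ...   | y , y∈xs , fy≢0 = y , there y∈xs , fy≢0

  module _ (f≥0 : ∀ x → 0ℤ ℤ.≤ f x) where

    sumℤ-nonneg : ∀ xs → 0ℤ ℤ.≤ sumℤ (map f xs)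
    sumℤ-nonneg [] = ℤ.≤-refl
    sumℤ-nonneg (x ∷ xs) = ℤ.+-mono-≤ (f≥0 x) (sumℤ-nonneg xs)

    sumℤ-pos : ∀ {x} xs → x ∈ xs → 0ℤ ℤ.< f x → 0ℤ ℤ.< sumℤ (map f xs)
    sumℤ-pos (y ∷ xs) (here refl) fx>0 = ℤ.+-mono-<-≤ fx>0 (sumℤ-nonneg xs)
    sumℤ-pos (y ∷ xs) (there x∈xs) fx>0 = ℤ.+-mono-≤-< (f≥0 y) (sumℤ-pos xs x∈xs fx>0)

NonNegCoeffs : Poly → Set
NonNegCoeffs p = ∀ i → 0ℤ ℤ.≤ p i

module _ {A : Set} (g : A → Poly) where

  sumP-apply : ∀ xs d → sumP (map g xs) d ≡ sumℤ (map (λ x → g x d) xs)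
  sumP-apply [] d = refl
  sumP-apply (x ∷ xs) d = cong (ℤ._+_ (g x d)) (sumP-apply xs d)

  sumP-≢0 : ∀ xs d → sumP (map g xs) d ≢ 0ℤ → Σ A λ x → x ∈ xs × g x d ≢ 0ℤ
  sumP-≢0 xs d sum≢0 = sumℤ-≢0 (λ x → g x d) xs (sum≢0 ∘ trans (sumP-apply xs d))

  module _ (g≥0 : ∀ x → NonNegCoeffs (g x)) where

    sumP-nonneg : ∀ xs → NonNegCoeffs (sumP (map g xs))
    sumP-nonneg xs d = subst (0ℤ ℤ.≤_) (sym (sumP-apply xs d)) (sumℤ-nonneg (λ x → g x d) (λ x → g≥0 x d) xs)

    sumP-pos : ∀ {x} xs d → x ∈ xs → 0ℤ ℤ.< g x d → 0ℤ ℤ.< sumP (map g xs) d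
    sumP-pos xs d x∈xs gx>0 = subst (0ℤ ℤ.<_) (sym (sumP-apply xs d)) (sumℤ-pos (λ x → g x d) (λ x → g≥0 x d) xs x∈xs gx>0)

hproj-nonneg : ∀ h {p} → NonNegCoeffs p → NonNegCoeffs (hproj h p)
hproj-nonneg h {p} p≥0 i with hamming i ≡ᵇ h
... | true = p≥0 i
... | false = ℤ.≤-refl

hproj-≢0 : ∀ h p d → hproj h p d ≢ 0ℤ → hamming d ≡ h × p d ≢ 0ℤ
hproj-≢0 h p d proj≢0 with hamming d ≡ᵇ h in eq
... | true = ≡ᵇ⇒≡ (hamming d) h (subst T (sym eq) _) , proj≢0
... | false = contradiction refl proj≢0

hproj-≡ : ∀ {h} p d → hamming d ≡ h → hproj h p d ≡ p d
hproj-≡ {h} p d hamming≡h with hamming d ≡ᵇ h | ≡⇒≡ᵇ (hamming d) h hamming≡h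
... | true | _ = refl

·-nonneg : ∀ {p q} → NonNegCoeffs p → NonNegCoeffs q → NonNegCoeffs (p · q)
·-nonneg {p} {q} p≥0 q≥0 k = sumℤ-nonneg (λ a → p a ℤ.* q (k ∸ a)) (λ a → *-nonneg (p≥0 a) (q≥0 (k ∸ a))) (upTo (suc k))

·-≢0 : ∀ p q k → (p · q) k ≢ 0ℤ → Σ ℕ λ a → Σ ℕ λ b → a + b ≡ k × p a ≢ 0ℤ × q b ≢ 0ℤ
·-≢0 p q k pq≢0 with a , a∈ , term≢0 ← sumℤ-≢0 (λ a → p a ℤ.* q (k ∸ a)) (upTo (suc k)) pq≢0 =
  a , k ∸ a , m+[n∸m]≡n (≤-pred (∈-upTo⁻ a∈)) , *-≢0 (p a) (q (k ∸ a)) term≢0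

·-pos : ∀ {p q} → NonNegCoeffs p → NonNegCoeffs q → ∀ {a b} → 0ℤ ℤ.< p a → 0ℤ ℤ.< q b → 0ℤ ℤ.< (p · q) (a + b)
·-pos {p} {q} p≥0 q≥0 {a} {b} pa>0 qb>0 =
  sumℤ-pos (λ c → p c ℤ.* q (a + b ∸ c)) (λ c → *-nonneg (p≥0 c) (q≥0 (a + b ∸ c))) (upTo (suc (a + b)))
    (∈-upTo⁺ (s≤s (m≤m+n a b))) (*-pos pa>0 (subst (λ c → 0ℤ ℤ.< q c) (sym (m+n∸m≡n a b)) qb>0))

starTerm : Poly → Poly → ℕ → ℕ → Poly
starTerm q r i j = hproj (i + j) (hproj i q · hproj j r)

starRow : ℕ → Poly → Poly → ℕ → Poly
starRow n q r i = sumP (map (starTerm q r i) (upTo (suc (n ∸ i))))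

-- star n q r is definitionally representative (starSum n q r).
starSum : ℕ → Poly → Poly → Poly
starSum n q r = sumP (map (starRow n q r) (upTo (suc n)))

CarryFreeSplit : Poly → Poly → ℕ → Set
CarryFreeSplit q r d = Σ ℕ λ a → Σ ℕ λ b → a + b ≡ d × hamming d ≡ hamming a + hamming b × q a ≢ 0ℤ × r b ≢ 0ℤ

starSum-≢0 : ∀ n q r d → starSum n q r d ≢ 0ℤ → CarryFreeSplit q r d
starSum-≢0 n q r d sum≢0
  with i , _ , row≢0 ← sumP-≢0 (starRow n q r) (upTo (suc n)) d sum≢0
  with j , _ , term≢0 ← sumP-≢0 (starTerm q r i) (upTo (suc (n ∸ i))) d row≢0
  with hd≡i+j , product≢0 ← hproj-≢0 (i + j) (hproj i q · hproj j r) d term≢0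
  with a , b , a+b≡d , qᵢa≢0 , rⱼb≢0 ← ·-≢0 (hproj i q) (hproj j r) d product≢0
  with ha≡i , qa≢0 ← hproj-≢0 i q a qᵢa≢0
  with hb≡j , rb≢0 ← hproj-≢0 j r b rⱼb≢0
  = a , b , a+b≡d , trans hd≡i+j (sym (cong₂ _+_ ha≡i hb≡j)) , qa≢0 , rb≢0

starSum-pos : ∀ n {q r} → NonNegCoeffs q → NonNegCoeffs r → ∀ {a b} →
  hamming (a + b) ≡ hamming a + hamming b → hamming (a + b) ≤ n →
  0ℤ ℤ.< q a → 0ℤ ℤ.< r b → 0ℤ ℤ.< starSum n q r (a + b)
starSum-pos n {q} {r} q≥0 r≥0 {a} {b} no-carries h≤n qa>0 rb>0 =
  sumP-pos (starRow n q r) (λ i → sumP-nonneg (starTerm q r i) (term≥0 i) (upTo (suc (n ∸ i))))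
           (upTo (suc n)) (a + b) (∈-upTo⁺ (s≤s (m+n≤o⇒m≤o i i+j≤n)))
    (sumP-pos (starTerm q r i) (term≥0 i) (upTo (suc (n ∸ i))) (a + b)
              (∈-upTo⁺ (s≤s (m+n≤o⇒m≤o∸n j (subst (_≤ n) (+-comm i j) i+j≤n))))
      term>0)
  where
  i j : ℕ
  i = hamming a
  j = hamming b
  i+j≤n : i + j ≤ n
  i+j≤n = subst (_≤ n) no-carries h≤n
  term≥0 : ∀ i j → NonNegCoeffs (starTerm q r i j)
  term≥0 i j = hproj-nonneg (i + j) (·-nonneg (hproj-nonneg i q≥0) (hproj-nonneg j r≥0))
  term>0 : 0ℤ ℤ.< starTerm q r i j (a + b)
  term>0 = subst (0ℤ ℤ.<_) (sym (hproj-≡ (hproj i q · hproj j r) (a + b) no-carries))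
             (·-pos (hproj-nonneg i q≥0) (hproj-nonneg j r≥0)
               (subst (0ℤ ℤ.<_) (sym (hproj-≡ q a refl)) qa>0)
               (subst (0ℤ ℤ.<_) (sym (hproj-≡ r b refl)) rb>0))

sumℤ-allSubsets-single : ∀ n (f : Subset n → ℤ) S₀ → (∀ S → S ≢ S₀ → f S ≡ 0ℤ) → sumℤ (map f (allSubsets n)) ≡ f S₀
sumℤ-allSubsets-single zero f [] _ = ℤ.+-identityʳ (f [])
sumℤ-allSubsets-single (suc n) f (b ∷ S₀) f-single = begin
  sumℤ (map f (map (inside ∷_) A ++ map (outside ∷_) A))                     ≡⟨ sumℤ-++ f (map (inside ∷_) A) (map (outside ∷_) A) ⟩
  sumℤ (map f (map (inside ∷_) A)) ℤ.+ sumℤ (map f (map (outside ∷_) A))     ≡⟨ cong₂ ℤ._+_ (cong sumℤ (List.map-∘ A)) (cong sumℤ (List.map-∘ A)) ⟨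
  sumℤ (map (f ∘ (inside ∷_)) A) ℤ.+ sumℤ (map (f ∘ (outside ∷_)) A)         ≡⟨ by-head b f-single ⟩
  f (b ∷ S₀)                                                                ∎
  where
  open ≡-Reasoning
  A : List (Subset n)
  A = allSubsets n
  tail-single : ∀ c → (∀ S → S ≢ c ∷ S₀ → f S ≡ 0ℤ) → ∀ S → S ≢ S₀ → f (c ∷ S) ≡ 0ℤ
  tail-single c single S S≢S₀ = single (c ∷ S) (S≢S₀ ∘ Vec.∷-injectiveʳ)
  other-head : ∀ c d → c ≢ d → (∀ S → S ≢ d ∷ S₀ → f S ≡ 0ℤ) → ∀ S → f (c ∷ S) ≡ 0ℤ
  other-head c d c≢d single S = single (c ∷ S) (c≢d ∘ Vec.∷-injectiveˡ)
  by-head : ∀ b → (∀ S → S ≢ b ∷ S₀ → f S ≡ 0ℤ) →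
    sumℤ (map (f ∘ (inside ∷_)) A) ℤ.+ sumℤ (map (f ∘ (outside ∷_)) A) ≡ f (b ∷ S₀)
  by-head true single = trans (cong₂ ℤ._+_ (sumℤ-allSubsets-single n (f ∘ (inside ∷_)) S₀ (tail-single inside single))
                                           (sumℤ-zero (f ∘ (outside ∷_)) A (other-head outside inside (λ ()) single)))
                              (ℤ.+-identityʳ _)
  by-head false single = trans (cong₂ ℤ._+_ (sumℤ-zero (f ∘ (inside ∷_)) A (other-head inside outside (λ ()) single))
                                            (sumℤ-allSubsets-single n (f ∘ (outside ∷_)) S₀ (tail-single outside single)))
                               (ℤ.+-identityˡ _)

codeIndicator : ∀ {n} → Family n → ℕ → Subset n → ℤ
codeIndicator G d S = if G S ∧ (val S ≡ᵇ d) then 1ℤ else 0ℤ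

HasCode : ∀ {n} → Family n → ℕ → Set
HasCode {n} G d = Σ (Subset n) λ S → T (G S) × val S ≡ d

pψ-nonneg : ∀ {n} (G : Family n) → NonNegCoeffs (pψ G)
pψ-nonneg {n} G d = sumℤ-nonneg (codeIndicator G d) indicator≥0 (allSubsets n)
  where
  indicator≥0 : ∀ S → 0ℤ ℤ.≤ codeIndicator G d S
  indicator≥0 S with G S ∧ (val S ≡ᵇ d)
  ... | true = +≤+ z≤n
  ... | false = +≤+ z≤n

pψ-≡1 : ∀ {n} (G : Family n) d → HasCode G d → pψ G d ≡ 1ℤ
pψ-≡1 {n} G d (S₀ , S₀∈G , valS₀≡d) = trans (sumℤ-allSubsets-single n (codeIndicator G d) S₀ unique) at-S₀
  where
  unique : ∀ S → S ≢ S₀ → codeIndicator G d S ≡ 0ℤ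
  unique S S≢S₀ with val S ≡ᵇ d in eq
  ... | true = contradiction (val-injective S S₀ (trans (≡ᵇ⇒≡ (val S) d (subst T (sym eq) _)) (sym valS₀≡d))) S≢S₀
  ... | false rewrite Bool.∧-zeroʳ (G S) = refl
  at-S₀ : codeIndicator G d S₀ ≡ 1ℤ
  at-S₀ = if-both-true S₀∈G (≡⇒≡ᵇ (val S₀) d valS₀≡d)
    where
    if-both-true : ∀ {b c} → T b → T c → (if b ∧ c then 1ℤ else 0ℤ) ≡ 1ℤ
    if-both-true {true} {true} _ _ = refl

pψ-≢0⇔HasCode : ∀ {n} (G : Family n) d → pψ G d ≢ 0ℤ ⇔ HasCode G d
pψ-≢0⇔HasCode {n} G d = mk⇔ code (λ hasCode pψ≡0 → 1≢0 (trans (sym (pψ-≡1 G d hasCode)) pψ≡0))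
  where
  1≢0 : 1ℤ ≢ 0ℤ
  1≢0 ()
  code : pψ G d ≢ 0ℤ → HasCode G d
  code pψ≢0 with S , _ , indicator≢0 ← sumℤ-≢0 (codeIndicator G d) (allSubsets n) pψ≢0
    with G S in eqG | val S ≡ᵇ d in eqV
  ... | true | true = S , subst T (sym eqG) _ , ≡ᵇ⇒≡ (val S) d (subst T (sym eqV) _)
  ... | true | false = contradiction refl indicator≢0
  ... | false | _ = contradiction refl indicator≢0

representative-0 : ∀ p i → p i ≡ 0ℤ → representative p i ≡ 0ℤ
representative-0 p i pi≡0 rewrite pi≡0 = refl

representative-≢0 : ∀ p i → p i ≢ 0ℤ → representative p i ≡ 1ℤ
representative-≢0 p i pi≢0 with p i
... | ℤ.+ zero = contradiction refl pi≢0
... | ℤ.+ suc _ = refl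
... | ℤ.-[1+ _ ] = refl

representative-≡ : ∀ (p q : Poly) i → (p i ≢ 0ℤ ⇔ q i ≢ 0ℤ) → (q i ≢ 0ℤ → q i ≡ 1ℤ) → representative p i ≡ q i
representative-≡ p q i same-support q-indicator with q i ℤ.≟ 0ℤ
... | yes qi≡0 = trans (representative-0 p i pi≡0) (sym qi≡0)
  where
  pi≡0 : p i ≡ 0ℤ
  pi≡0 = decidable-stable (p i ℤ.≟ 0ℤ) (λ pi≢0 → Equivalence.to same-support pi≢0 qi≡0)
... | no qi≢0 = trans (representative-≢0 p i (Equivalence.from same-support qi≢0)) (sym (q-indicator qi≢0))

IsDisjointUnion : ∀ {n} → Family n → Family n → Family n → Set
IsDisjointUnion {n} F₁ F₂ F = ∀ S → T (F S) ⇔ Σ (Subset n) (λ S₁ → Σ (Subset n) (λ S₂ →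
  T (F₁ S₁) × T (F₂ S₂) × (S₁ ∩ S₂ ≡ ⊥) × (S ≡ S₁ ∪ S₂)))

disjointUnion-code : ∀ {n} {F₁ F₂ F : Family n} → IsDisjointUnion F₁ F₂ F → ∀ {a b} →
  HasCode F₁ a → HasCode F₂ b → hamming (a + b) ≡ hamming a + hamming b → HasCode F (a + b)
disjointUnion-code F≡F₁⊎F₂ (S₁ , S₁∈F₁ , refl) (S₂ , S₂∈F₂ , refl) no-carries =
  S₁ ∪ S₂ , Equivalence.from (F≡F₁⊎F₂ (S₁ ∪ S₂)) (S₁ , S₂ , S₁∈F₁ , S₂∈F₂ , disjoint , refl) , val-∪ S₁ S₂ disjoint
  where
  disjoint : S₁ ∩ S₂ ≡ ⊥
  disjoint = Equivalence.from (disjoint⇔hamming-val+val≡ S₁ S₂)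
               (trans no-carries (cong₂ _+_ (hamming-val S₁) (hamming-val S₂)))

pψ-code-pos : ∀ {n} (G : Family n) {S} → T (G S) → 0ℤ ℤ.< pψ G (val S)
pψ-code-pos G {S} S∈G = subst (0ℤ ℤ.<_) (sym (pψ-≡1 G (val S) (S , S∈G , refl))) (+<+ (s≤s z≤n))

starSum-pψ-pos : ∀ {n} {F₁ F₂ : Family n} {S₁ S₂} → T (F₁ S₁) → T (F₂ S₂) → S₁ ∩ S₂ ≡ ⊥ →
  0ℤ ℤ.< starSum n (pψ F₁) (pψ F₂) (val (S₁ ∪ S₂))
starSum-pψ-pos {n} {F₁} {F₂} {S₁} {S₂} S₁∈F₁ S₂∈F₂ disjoint =
  subst (λ d → 0ℤ ℤ.< starSum n (pψ F₁) (pψ F₂) d) (sym (val-∪ S₁ S₂ disjoint))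
    (starSum-pos n (pψ-nonneg F₁) (pψ-nonneg F₂) no-carries h≤n (pψ-code-pos F₁ S₁∈F₁) (pψ-code-pos F₂ S₂∈F₂))
  where
  no-carries : hamming (val S₁ + val S₂) ≡ hamming (val S₁) + hamming (val S₂)
  no-carries = trans (Equivalence.to (disjoint⇔hamming-val+val≡ S₁ S₂) disjoint)
                     (sym (cong₂ _+_ (hamming-val S₁) (hamming-val S₂)))
  h≤n : hamming (val S₁ + val S₂) ≤ n
  h≤n = begin
    hamming (val S₁ + val S₂)  ≡⟨ cong hamming (val-∪ S₁ S₂ disjoint) ⟨
    hamming (val (S₁ ∪ S₂))    ≡⟨ hamming-val (S₁ ∪ S₂) ⟩
    ∣ S₁ ∪ S₂ ∣                ≤⟨ ∣p∣≤n (S₁ ∪ S₂) ⟩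
    n                          ∎
    where open ≤-Reasoning

carryFreeSplit⇒HasCode : ∀ {n} {F₁ F₂ F : Family n} → IsDisjointUnion F₁ F₂ F → ∀ {d} →
  CarryFreeSplit (pψ F₁) (pψ F₂) d → HasCode F d
carryFreeSplit⇒HasCode {F₁ = F₁} {F₂} F≡F₁⊎F₂ (a , b , refl , no-carries , pa≢0 , pb≢0) =
  disjointUnion-code F≡F₁⊎F₂ (Equivalence.to (pψ-≢0⇔HasCode F₁ a) pa≢0) (Equivalence.to (pψ-≢0⇔HasCode F₂ b) pb≢0) no-carries

starSum-pψ-≢0⇔HasCode : ∀ {n} {F₁ F₂ F : Family n} → IsDisjointUnion F₁ F₂ F →
  ∀ d → starSum n (pψ F₁) (pψ F₂) d ≢ 0ℤ ⇔ HasCode F d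
starSum-pψ-≢0⇔HasCode {n} {F₁} {F₂} {F} F≡F₁⊎F₂ d =
  mk⇔ (carryFreeSplit⇒HasCode F≡F₁⊎F₂ ∘ starSum-≢0 n (pψ F₁) (pψ F₂) d) split-code
  where
  split-code : HasCode F d → starSum n (pψ F₁) (pψ F₂) d ≢ 0ℤ
  split-code (S , S∈F , valS≡d) with Equivalence.to (F≡F₁⊎F₂ S) S∈F
  ... | S₁ , S₂ , S₁∈F₁ , S₂∈F₂ , disjoint , S≡S₁∪S₂ =
    ℤ.<⇒≢ (subst (λ x → 0ℤ ℤ.< starSum n (pψ F₁) (pψ F₂) x) (trans (cong val (sym S≡S₁∪S₂)) valS≡d)
                 (starSum-pψ-pos S₁∈F₁ S₂∈F₂ disjoint)) ∘ sym

mainTheorem14 : (n : ℕ) (F₁ F₂ F : Family n) →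
  (∀ S → T (F S) ⇔ Σ (Subset n) (λ S₁ → Σ (Subset n) (λ S₂ →
        T (F₁ S₁) × T (F₂ S₂) × (S₁ ∩ S₂ ≡ ⊥) × (S ≡ S₁ ∪ S₂)))) →
  ∀ d → star n (pψ F₁) (pψ F₂) d ≡ pψ F d
mainTheorem14 n F₁ F₂ F F≡F₁⊎F₂ d =
  representative-≡ (starSum n (pψ F₁) (pψ F₂)) (pψ F) d
    (⇔-sym (pψ-≢0⇔HasCode F d) ⇔-∘ starSum-pψ-≢0⇔HasCode F≡F₁⊎F₂ d)
    (pψ-≡1 F d ∘ Equivalence.to (pψ-≢0⇔HasCode F d))
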